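{- Let $(I,<,\mathcal X,R,\mathrm{Mor})$ be a regular groupoid spine. Then: (1) there is a symmetric set $S\subseteq I^2$ with $S\supseteq R$ such that $(I,<,\mathcal X,R,\mathrm{Mor})$ extends to $S$; (2) in particular, if $|I|\ge 3$, then $(I,<,\mathcal X,R,\mathrm{Mor})$ extends to a groupoid.
   Context: A groupoid spine $(I,<,\mathcal X,R,\mathrm{Mor})$ consists of a linear order $(I,<)$; a family $\mathcal X=\{X_i:i\in I\}$ of non-empty sets; a non-empty relation $R\subseteq I^2$ containing every pair $(i,j)$ with $i<j$; and for each $(i,j)\in R$ a non-empty set $\operatorname{Mor}(i,j)$ of bijections $X_i\to X_j$, such that: (1) if $(i,i)\in R$ then $\mathrm{id}_{X_i}\in\operatorname{Mor}(i,i)$; (2) if $(i,j),(j,i)\in R$ and $f\in\operatorname{Mor}(i,j)$ then $f^{ -1}\in\operatorname{Mor}(j,i)$; (3) if $(i,j),(j,k),(i,k)\in R$, $f\in\operatorname{Mor}(i,j)$, $g\in\operatorname{Mor}(j,k)$, then $g\circ f\in\operatorname{Mor}(i,k)$. It is regular if for every $(i,j)\in R$, $x\in X_i$, $y\in X_j$ there is exactly one $f\in\operatorname{Mor}(i,j)$ with $f(x)=y$. For $R\subseteq S\subseteq I^2$, it extends to $S$ if one can define $\operatorname{Mor}(i,j)$ for $(i,j)\in S\setminus R$ (keeping $\operatorname{Mor}(i,j)$ unchanged for $(i,j)\in R$) so that $(I,<,\mathcal X,S,\mathrm{Mor})$ is a groupoid spine; it extends to a groupoid if it extends to $S=I^2$.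 A set $S\subseteq I^2$ is symmetric if $(i,j)\in S$ implies $(j,i)\in S$. -}

module Defs where

open import Data.Product using (Σ; ∃; _×_; _,_)
open import Data.Unit using (⊤)
open import Function using (id; _∘_; _⇔_)
open import Relation.Nullary using (¬_)
open import Relation.Binary.PropositionalEquality using (_≡_)
open import Relation.Binary.Structures using (IsStrictTotalOrder)

IsBijection : {A B : Set} → (A → B) → Set
IsBijection {A} {B} f =
  (∀ (x y : A) → f x ≡ f y → x ≡ y) × (∀ (y : B) → ∃ λ x → f x ≡ y)

IsInverse : {A B : Set} → (A → B) → (B → A) → Set
IsInverse f g = (∀ x → g (f x) ≡ x) × (∀ y → f (g y) ≡ y)

MorFamily : {I : Set} → (I → Set) → Set₁
MorFamily {I} X = (i j : I) → (X i → X j) → Set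

record IsGroupoidSpine (I : Set) (_<_ : I → I → Set) (X : I → Set)
         (R : I → I → Set) (Mor : MorFamily X) : Set where
  field
    linear       : IsStrictTotalOrder _≡_ _<_
    X-nonempty   : ∀ i → X i
    R-nonempty   : Σ I λ i → Σ I λ j → R i j
    <⊆R          : ∀ {i j} → i < j → R i j
    Mor-nonempty : ∀ {i j} → R i j → ∃ λ f → Mor i j f
    Mor-bij      : ∀ {i j} → R i j → ∀ f → Mor i j f → IsBijection f
    -- sets of functions are extensional (membership respects pointwise equality)
    Mor-ext      : ∀ {i j} → R i j → ∀ f g → Mor i j f → (∀ x → f x ≡ g x) → Mor i j g
    id-closed    : ∀ {i} → R i i → Mor i i id
    inv-closed   : ∀ {i j} → R i j → R j i → ∀ f g →
                   Mor i j f → IsInverse f g → Mor j i g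
    comp-closed  : ∀ {i j k} → R i j → R j k → R i k → ∀ f g →
                   Mor i j f → Mor j k g → Mor i k (g ∘ f)

IsRegular : {I : Set} (X : I → Set) (R : I → I → Set) (Mor : MorFamily X) → Set
IsRegular {I} X R Mor =
  ∀ {i j : I} → R i j → ∀ (x : X i) (y : X j) →
    Σ (X i → X j) λ f → (Mor i j f × f x ≡ y) ×
      (∀ g → Mor i j g → g x ≡ y → ∀ z → g z ≡ f z)

Symmetric : {I : Set} → (I → I → Set) → Set
Symmetric {I} S = ∀ {i j : I} → S i j → S j i

-- (I,<,X,R,Mor) extends to S (R ⊆ S assumed separately)
ExtendsTo : (I : Set) (_<_ : I → I → Set) (X : I → Set)
            (R : I → I → Set) (Mor : MorFamily X) (S : I → I → Set) → Set₁
ExtendsTo I _<_ X R Mor S =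
  Σ (MorFamily X) λ Mor′ →
    (∀ i j → R i j → ∀ f → Mor′ i j f ⇔ Mor i j f) ×
    IsGroupoidSpine I _<_ X S Mor′

ExtendsToGroupoid : (I : Set) (_<_ : I → I → Set) (X : I → Set)
                    (R : I → I → Set) (Mor : MorFamily X) → Set₁
ExtendsToGroupoid I _<_ X R Mor = ExtendsTo I _<_ X R Mor (λ _ _ → ⊤)

AtLeastThree : Set → Set
AtLeastThree I = Σ I λ a → Σ I λ b → Σ I λ c →
  ¬ a ≡ b × ¬ a ≡ c × ¬ b ≡ c

-- Put Morˢ(i,j) = Mor(i,j) when (i,j) ∈ R and Mor(j,i)⁻¹ when (j,i) ∈ R; this is
-- well defined by closure under inverses, and it is regular on the symmetric
-- closure of R because Mor is regular on R. By regularity, closure of a triangle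
-- (i,j,k) under composition is invariant under permuting i, j, k, and for the
-- sorted order it is closure of Mor itself, since then all three pairs lie in R.
--
-- Every pair of distinct indices is comparable, so only the diagonal is missing
-- from the symmetric closure. Let Mor(i,i) consist of the g with p ∘ g ∈ Morˢ(i,k)
-- whenever k ≠ i and p ∈ Morˢ(i,k). A third index is what makes a loop
-- i → j → i act on Morˢ(i,j): compose through Morˢ(j,k) and cancel it again.

module Submission where

open import Defs
open import Data.Product using (Σ; ∃; _×_; _,_; proj₁; proj₂)
open import Data.Sum using (inj₁; inj₂)
open import Data.Unit using (⊤; tt)
open import Function using (id; _∘_; _⇔_; mk⇔)
open import Relation.Nullary using (yes; no; contradiction)
open import Relation.Binary.Definitions using (DecidableEquality; tri<; tri≈; tri>)
open import Relation.Binary.Structures using (IsStrictTotalOrder; IsTotalOrder)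
open import Relation.Binary.PropositionalEquality
  using (_≡_; _≢_; _≗_; refl; sym; trans; cong; ≢-sym; module ≡-Reasoning)
open import Relation.Binary.Construct.Closure.Symmetric using (SymClosure; fwd; bwd; symmetric)
import Relation.Binary.Construct.StrictToNonStrict as StrictToNonStrict

private
  variable
    A B C : Set

IsInverse-sym : {f : A → B} {g : B → A} → IsInverse f g → IsInverse g f
IsInverse-sym (gf , fg) = fg , gf

IsInverse⇒IsBijection : {f : A → B} {g : B → A} → IsInverse f g → IsBijection f
IsInverse⇒IsBijection {f = f} {g} (gf , fg) =
  (λ x y fx≡fy → trans (sym (gf x)) (trans (cong g fx≡fy) (gf y))) , λ y → g y , fg y

inverse : {f : A → B} → IsBijection f → B → A
inverse (_ , surjective) y = proj₁ (surjective y)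

inverse-isInverse : {f : A → B} (bij : IsBijection f) → IsInverse f (inverse bij)
inverse-isInverse {f = f} (injective , surjective) =
  (λ x → injective _ x (proj₂ (surjective (f x)))) , λ y → proj₂ (surjective y)

IsInverse-∘ : {f : A → B} {f′ : B → A} {g : B → C} {g′ : C → B} →
              IsInverse f f′ → IsInverse g g′ → IsInverse (g ∘ f) (f′ ∘ g′)
IsInverse-∘ {f = f} {f′} {g} {g′} (f′f , ff′) (g′g , gg′) =
  (λ x → trans (cong f′ (g′g (f x))) (f′f x)) ,
  (λ z → trans (cong g (ff′ (g′ z))) (gg′ z))

inverse-∘-isInverse : {f : A → B} {g : B → C} (bf : IsBijection f) (bg : IsBijection g) →
                      IsInverse (inverse bf ∘ inverse bg) (g ∘ f)
inverse-∘-isInverse {f = f} {g} bf bg =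
  IsInverse-sym {f = g ∘ f}
    (IsInverse-∘ {f = f} {inverse bf} {g} {inverse bg} (inverse-isInverse bf) (inverse-isInverse bg))

IsInverse-respˡ : {f f′ : A → B} {g : B → A} → IsInverse f g → f ≗ f′ → IsInverse f′ g
IsInverse-respˡ {g = g} (gf , fg) f≗f′ =
  (λ x → trans (cong g (sym (f≗f′ x))) (gf x)) , (λ y → trans (sym (f≗f′ (g y))) (fg y))

inverse-unique : {f : A → B} {g g′ : B → A} → IsInverse f g → IsInverse f g′ → g ≗ g′
inverse-unique {f = f} {g} {g′} (gf , _) (_ , fg′) y =
  trans (cong g (sym (fg′ y))) (gf (g′ y))

IsBijection-resp : {f f′ : A → B} → IsBijection f → f ≗ f′ → IsBijection f′
IsBijection-resp bij f≗f′ = IsInverse⇒IsBijection (IsInverse-respˡ (inverse-isInverse bij) f≗f′)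

IsBijection-∘ : {f : A → B} {g : B → C} → IsBijection f → IsBijection g → IsBijection (g ∘ f)
IsBijection-∘ {f = f} {g} bf bg =
  IsInverse⇒IsBijection {f = g ∘ f}
    (IsInverse-∘ {f = f} {inverse bf} {g} {inverse bg} (inverse-isInverse bf) (inverse-isInverse bg))

avoid-two : DecidableEquality A → AtLeastThree A → (i j : A) → ∃ λ k → i ≢ k × j ≢ k
avoid-two _≟_ (a , b , c , a≢b , a≢c , b≢c) i j with i ≟ a | j ≟ a
... | no i≢a   | no j≢a = a , i≢a , j≢a
... | yes refl | _ with j ≟ b
...   | no j≢b   = b , a≢b , j≢b
...   | yes refl = c , a≢c , b≢c
avoid-two _≟_ (a , b , c , a≢b , a≢c , b≢c) i j | no i≢a | yes refl with i ≟ b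
...   | no i≢b   = b , i≢b , a≢b
...   | yes refl = c , b≢c , a≢c

module SymmetricExtension
    {I : Set} {_<_ : I → I → Set} {X : I → Set} {R : I → I → Set} {Mor : MorFamily X}
    (spine : IsGroupoidSpine I _<_ X R Mor) (regular : IsRegular X R Mor) where

  open IsGroupoidSpine spine
  open IsStrictTotalOrder linear using (compare)
  open StrictToNonStrict _≡_ _<_ using (_≤_; isTotalOrder)
  open IsTotalOrder (isTotalOrder linear) using (total) renaming (trans to ≤-trans)

  private
    variable
      i j k : I

  Mor-unique : R i j → ∀ {f f′} → Mor i j f → Mor i j f′ → ∀ {x} → f x ≡ f′ x → f ≗ f′
  Mor-unique r {f} {f′} m m′ {x} fx≡f′x z with regular r x (f x)
  ... | _ , _ , unique = trans (unique f m refl z) (sym (unique f′ m′ (sym fx≡f′x) z))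

  Rˢ : I → I → Set
  Rˢ = SymClosure R

  Rˢ-sym : Symmetric Rˢ
  Rˢ-sym = symmetric R

  ≢⇒Rˢ : i ≢ j → Rˢ i j
  ≢⇒Rˢ {i} {j} i≢j with compare i j
  ... | tri< i<j _ _ = fwd (<⊆R i<j)
  ... | tri≈ _ i≡j _ = contradiction i≡j i≢j
  ... | tri> _ _ j<i = bwd (<⊆R j<i)

  R-of-≤ : i ≤ j → Rˢ i j → R i j
  R-of-≤ (inj₁ i<j) _       = <⊆R i<j
  R-of-≤ (inj₂ refl) (fwd r) = r
  R-of-≤ (inj₂ refl) (bwd r) = r

  record Morˢ (i j : I) (f : X i → X j) : Set where
    field
      bijective : IsBijection f
      forward   : R i j → Mor i j f
      backward  : R j i → ∀ g → IsInverse f g → Mor j i g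

  open Morˢ

  Mor⇒Morˢ : R i j → ∀ {f} → Mor i j f → Morˢ i j f
  Mor⇒Morˢ r {f} m = record
    { bijective = Mor-bij r f m
    ; forward   = λ _ → m
    ; backward  = λ r′ g inv → inv-closed r r′ f g m inv
    }

  Morˢ⇔Mor : R i j → ∀ f → Morˢ i j f ⇔ Mor i j f
  Morˢ⇔Mor r f = mk⇔ (λ m → forward m r) (Mor⇒Morˢ r)

  Morˢ-resp : ∀ {f f′} → Morˢ i j f → f ≗ f′ → Morˢ i j f′
  Morˢ-resp {f = f} {f′} m f≗f′ = record
    { bijective = IsBijection-resp (bijective m) f≗f′
    ; forward   = λ r → Mor-ext r f f′ (forward m r) f≗f′
    ; backward  = λ r g inv → backward m r g (IsInverse-respˡ inv (sym ∘ f≗f′))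
    }

  Morˢ-inverse : ∀ {f g} → Morˢ i j f → IsInverse f g → Morˢ j i g
  Morˢ-inverse {f = f} {g} m inv = record
    { bijective = IsInverse⇒IsBijection (IsInverse-sym {f = f} inv)
    ; forward   = λ r → backward m r g inv
    ; backward  = λ r f′ inv′ →
        Mor-ext r f f′ (forward m r) (inverse-unique (IsInverse-sym {f = f} inv) inv′)
    }

  Morˢ-⁻¹ : ∀ {f} (m : Morˢ i j f) → Morˢ j i (inverse (bijective m))
  Morˢ-⁻¹ m = Morˢ-inverse m (inverse-isInverse (bijective m))

  Morˢ-exists : Rˢ i j → ∀ x y → ∃ λ f → Morˢ i j f × f x ≡ y
  Morˢ-exists (fwd r) x y with regular r x y
  ... | f , (m , fx≡y) , _ = f , Mor⇒Morˢ r m , fx≡y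
  Morˢ-exists (bwd r) x y with regular r y x
  ... | h , (m , hy≡x) , _ =
    inverse bij , Morˢ-⁻¹ mˢ , trans (cong (inverse bij) (sym hy≡x)) (proj₁ (inverse-isInverse bij) y)
    where
      mˢ  = Mor⇒Morˢ r m
      bij = bijective mˢ

  Morˢ-nonempty : Rˢ i j → ∃ (Morˢ i j)
  Morˢ-nonempty {i} {j} s with Morˢ-exists s (X-nonempty i) (X-nonempty j)
  ... | f , m , _ = f , m

  -- In the backward case the inverses lie in Mor(j,i) and agree at f x.
  Morˢ-unique : Rˢ i j → ∀ {f f′} → Morˢ i j f → Morˢ i j f′ → ∀ {x} → f x ≡ f′ x → f ≗ f′
  Morˢ-unique (fwd r) m m′ fx≡f′x = Mor-unique r (forward m r) (forward m′ r) fx≡f′x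
  Morˢ-unique (bwd r) {f} {f′} m m′ {x} fx≡f′x =
    inverse-unique (IsInverse-respˡ (IsInverse-sym {f = f} inv) g≗g′) (IsInverse-sym {f = f′} inv′)
    where
      inv  = inverse-isInverse (bijective m)
      inv′ = inverse-isInverse (bijective m′)
      g≗g′ = Mor-unique r (backward m r _ inv) (backward m′ r _ inv′)
               (trans (proj₁ inv x) (sym (trans (cong (inverse (bijective m′)) fx≡f′x) (proj₁ inv′ x))))

  CompClosed : I → I → I → Set
  CompClosed i j k = ∀ {f g} → Morˢ i j f → Morˢ j k g → Morˢ i k (g ∘ f)

  CompClosed-reverse : CompClosed i j k → CompClosed k j i
  CompClosed-reverse closed mf mg =
    Morˢ-inverse (closed (Morˢ-⁻¹ mg) (Morˢ-⁻¹ mf)) (inverse-∘-isInverse (bijective mf) (bijective mg))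

  -- For f ∈ Morˢ(j,i), g ∈ Morˢ(i,k), take r ∈ Morˢ(j,k) agreeing with g ∘ f at one
  -- point; then r ∘ f⁻¹ ∈ Morˢ(i,k) agrees with g at one point, hence everywhere.
  CompClosed-swap₁₂ : Rˢ j k → Rˢ i k → CompClosed i j k → CompClosed j i k
  CompClosed-swap₁₂ {j} s-jk s-ik closed {f} {g} mf mg
    with Morˢ-exists s-jk (X-nonempty j) (g (f (X-nonempty j)))
  ... | r , mr , r≡g∘f = Morˢ-resp mr r≗g∘f
    where
      open ≡-Reasoning
      f⁻¹f = proj₁ (inverse-isInverse (bijective mf))
      r∘f⁻¹≗g = Morˢ-unique s-ik (closed (Morˢ-⁻¹ mf) mr)
                  mg (trans (cong r (f⁻¹f (X-nonempty j))) r≡g∘f)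
      r≗g∘f : r ≗ g ∘ f
      r≗g∘f z = begin
        r z                                    ≡⟨ cong r (sym (f⁻¹f z)) ⟩
        r (inverse (bijective mf) (f z))       ≡⟨ r∘f⁻¹≗g (f z) ⟩
        g (f z)                                ∎

  CompClosed-swap₂₃ : Rˢ i j → Rˢ i k → CompClosed i j k → CompClosed i k j
  CompClosed-swap₂₃ s-ij s-ik =
    CompClosed-reverse ∘ CompClosed-swap₁₂ (Rˢ-sym s-ij) (Rˢ-sym s-ik) ∘ CompClosed-reverse

  CompClosed-sorted : i ≤ j → j ≤ k → Rˢ i j → Rˢ j k → Rˢ i k → CompClosed i j k
  CompClosed-sorted i≤j j≤k s-ij s-jk s-ik {f} {g} mf mg =
    Mor⇒Morˢ r-ik (comp-closed r-ij r-jk r-ik f g (forward mf r-ij) (forward mg r-jk))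
    where
      r-ij = R-of-≤ i≤j s-ij
      r-jk = R-of-≤ j≤k s-jk
      r-ik = R-of-≤ (≤-trans i≤j j≤k) s-ik

  Morˢ-∘ : Rˢ i j → Rˢ j k → Rˢ i k → CompClosed i j k
  Morˢ-∘ {i} {j} {k} s-ij s-jk s-ik with total i j | total j k | total i k
  ... | inj₁ i≤j | inj₁ j≤k | _ = CompClosed-sorted i≤j j≤k s-ij s-jk s-ik
  ... | inj₁ i≤j | inj₂ k≤j | inj₁ i≤k =
    CompClosed-swap₂₃ s-ik s-ij (CompClosed-sorted i≤k k≤j s-ik (Rˢ-sym s-jk) s-ij)
  ... | inj₁ i≤j | inj₂ k≤j | inj₂ k≤i =
    CompClosed-reverse (CompClosed-swap₂₃ (Rˢ-sym s-ik) (Rˢ-sym s-jk)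
      (CompClosed-sorted k≤i i≤j (Rˢ-sym s-ik) s-ij (Rˢ-sym s-jk)))
  ... | inj₂ j≤i | inj₁ j≤k | inj₁ i≤k =
    CompClosed-swap₁₂ s-ik s-jk (CompClosed-sorted j≤i i≤k (Rˢ-sym s-ij) s-ik s-jk)
  ... | inj₂ j≤i | inj₁ j≤k | inj₂ k≤i =
    CompClosed-reverse (CompClosed-swap₁₂ (Rˢ-sym s-ik) (Rˢ-sym s-ij)
      (CompClosed-sorted j≤k k≤i s-jk (Rˢ-sym s-ik) (Rˢ-sym s-ij)))
  ... | inj₂ j≤i | inj₂ k≤j | _ =
    CompClosed-reverse (CompClosed-sorted k≤j j≤i (Rˢ-sym s-jk) (Rˢ-sym s-ij) (Rˢ-sym s-ik))

  isGroupoidSpineˢ : IsGroupoidSpine I _<_ X Rˢ Morˢ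
  isGroupoidSpineˢ = record
    { linear       = linear
    ; X-nonempty   = X-nonempty
    ; R-nonempty   = let (i , j , r) = R-nonempty in i , j , fwd r
    ; <⊆R          = fwd ∘ <⊆R
    ; Mor-nonempty = Morˢ-nonempty
    ; Mor-bij      = λ _ _ → bijective
    ; Mor-ext      = λ _ _ _ → Morˢ-resp
    ; id-closed    = λ s → let r = R-of-≤ (inj₂ refl) s in Mor⇒Morˢ r (id-closed r)
    ; inv-closed   = λ _ _ _ _ → Morˢ-inverse
    ; comp-closed  = λ s-ij s-jk s-ik _ _ → Morˢ-∘ s-ij s-jk s-ik
    }

  extendsToSymClosure : ExtendsTo I _<_ X R Mor Rˢ
  extendsToSymClosure = Morˢ , (λ _ _ → Morˢ⇔Mor) , isGroupoidSpineˢ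

module GroupoidExtension
    {I : Set} {_<_ : I → I → Set} {X : I → Set} {R : I → I → Set} {Mor : MorFamily X}
    (spine : IsGroupoidSpine I _<_ X R Mor) (regular : IsRegular X R Mor)
    (three : AtLeastThree I) where

  open IsGroupoidSpine spine
  open IsStrictTotalOrder linear using (_≟_)
  open SymmetricExtension spine regular
  open Morˢ

  private
    variable
      i j k : I

  other : ∀ i j → ∃ λ k → i ≢ k × j ≢ k
  other = avoid-two _≟_ three

  neighbour : ∀ i → ∃ λ k → i ≢ k × ∃ (Morˢ i k)
  neighbour i with other i i
  ... | k , i≢k , _ = k , i≢k , Morˢ-nonempty (≢⇒Rˢ i≢k)

  ActsRight : (i : I) → (X i → X i) → Set
  ActsRight i g = ∀ {k} → i ≢ k → ∀ {p} → Morˢ i k p → Morˢ i k (p ∘ g)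

  actsRight-id : ActsRight i id
  actsRight-id _ m = m

  actsRight-resp : ∀ {g g′} → ActsRight i g → g ≗ g′ → ActsRight i g′
  actsRight-resp acts g≗g′ i≢k {p} m = Morˢ-resp (acts i≢k m) (cong p ∘ g≗g′)

  actsRight-∘ : ∀ {f g} → ActsRight i f → ActsRight i g → ActsRight i (g ∘ f)
  actsRight-∘ f-acts g-acts i≢k = f-acts i≢k ∘ g-acts i≢k

  -- p ∘ g′ is the member r of Morˢ(i,k) with r ∘ g = p, found by regularity.
  actsRight-inverse : ∀ {g g′} → ActsRight i g → IsInverse g g′ → ActsRight i g′
  actsRight-inverse {i} {g} {g′} acts (_ , gg′) i≢k {p} mp
    with Morˢ-exists (≢⇒Rˢ i≢k) (g (X-nonempty i)) (p (X-nonempty i))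
  ... | r , mr , r∘g≡p = Morˢ-resp mr r≗p∘g′
    where
      r∘g≗p = Morˢ-unique (≢⇒Rˢ i≢k) (acts i≢k mr) mp r∘g≡p
      r≗p∘g′ : r ≗ p ∘ g′
      r≗p∘g′ y = trans (cong r (sym (gg′ y))) (r∘g≗p (g′ y))

  actsRight⇒IsBijection : ∀ {g} → ActsRight i g → IsBijection g
  actsRight⇒IsBijection {i} {g} acts with neighbour i
  ... | k , i≢k , p , mp = IsBijection-resp (IsBijection-∘ (bijective (acts i≢k mp)) p⁻¹-bij) (p⁻¹p ∘ g)
    where
      p⁻¹-bij = bijective (Morˢ-⁻¹ mp)
      p⁻¹p    = proj₁ (inverse-isInverse (bijective mp))

  actsRight⇔Mor : R i i → ∀ g → ActsRight i g ⇔ Mor i i g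
  actsRight⇔Mor {i} r g = mk⇔ to from
    where
      to : ActsRight i g → Mor i i g
      to acts with neighbour i
      ... | k , i≢k , p , mp = forward (Morˢ-resp loop (proj₁ (inverse-isInverse (bijective mp)) ∘ g)) r
        where
          loop = Morˢ-∘ (≢⇒Rˢ i≢k) (≢⇒Rˢ (≢-sym i≢k)) (fwd r) (acts i≢k mp) (Morˢ-⁻¹ mp)
      from : Mor i i g → ActsRight i g
      from m i≢k = Morˢ-∘ (fwd r) (≢⇒Rˢ i≢k) (≢⇒Rˢ i≢k) (Mor⇒Morˢ r m)

  actsRight⇒actsLeft : ∀ {f g} → ActsRight j g → i ≢ j → Morˢ i j f → Morˢ i j (g ∘ f)
  actsRight⇒actsLeft {g = g} acts i≢j mf =
    Morˢ-inverse (acts⁻¹ (≢-sym i≢j) (Morˢ-⁻¹ mf)) (inverse-∘-isInverse (bijective mf) g-bij)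
    where
      g-bij  = actsRight⇒IsBijection acts
      acts⁻¹ = actsRight-inverse acts (inverse-isInverse g-bij)

  -- With t ∈ Morˢ(b,c) for a third index c, p′ ∘ q ∘ p = t⁻¹ ∘ t ∘ p′ ∘ q ∘ p, and every
  -- partial composite runs along the triangle of distinct indices a, b, c.
  heap-closed : ∀ {a b p q p′} → a ≢ b → Morˢ a b p → Morˢ b a q → Morˢ a b p′ →
                Morˢ a b (p′ ∘ q ∘ p)
  heap-closed {a} {b} a≢b mp mq mp′ with other a b
  ... | c , a≢c , b≢c with Morˢ-nonempty (≢⇒Rˢ b≢c)
  ... | t , mt = Morˢ-resp (Morˢ-∘ s-ac s-cb s-ab m-t∘p′∘q∘p (Morˢ-⁻¹ mt)) (t⁻¹t ∘ _)
    where
      s-ab = ≢⇒Rˢ a≢b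
      s-ba = Rˢ-sym s-ab
      s-ac = ≢⇒Rˢ a≢c
      s-bc = ≢⇒Rˢ b≢c
      s-cb = Rˢ-sym s-bc
      t⁻¹t = proj₁ (inverse-isInverse (bijective mt))
      m-t∘p′∘q∘p =
        Morˢ-∘ s-ab s-bc s-ac mp (Morˢ-∘ s-ba s-ac s-bc mq (Morˢ-∘ s-ab s-bc s-ac mp′ mt))

  loop-actsRight : ∀ {f g} → i ≢ j → Morˢ i j f → Morˢ j i g → ActsRight i (g ∘ f)
  loop-actsRight {i} {j} i≢j mf mg {k} i≢k mp with j ≟ k
  ... | yes refl = heap-closed i≢j mf mg mp
  ... | no j≢k   = Morˢ-∘ s-ij (≢⇒Rˢ j≢k) s-ik mf (Morˢ-∘ (Rˢ-sym s-ij) s-ik (≢⇒Rˢ j≢k) mg mp)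
    where
      s-ij = ≢⇒Rˢ i≢j
      s-ik = ≢⇒Rˢ i≢k

  Morᵍ : MorFamily X
  Morᵍ i j f with i ≟ j
  ... | yes refl = ActsRight i f
  ... | no _     = Morˢ i j f

  Morᵍ-nonempty : ∀ i j → ∃ (Morᵍ i j)
  Morᵍ-nonempty i j with i ≟ j
  ... | yes refl = id , actsRight-id
  ... | no i≢j   = Morˢ-nonempty (≢⇒Rˢ i≢j)

  Morᵍ-bij : ∀ {f} → Morᵍ i j f → IsBijection f
  Morᵍ-bij {i} {j} m with i ≟ j
  ... | yes refl = actsRight⇒IsBijection m
  ... | no _     = bijective m

  Morᵍ-resp : ∀ {f f′} → Morᵍ i j f → f ≗ f′ → Morᵍ i j f′
  Morᵍ-resp {i} {j} m with i ≟ j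
  ... | yes refl = actsRight-resp m
  ... | no _     = Morˢ-resp m

  Morᵍ-id : Morᵍ i i id
  Morᵍ-id {i} with i ≟ i
  ... | yes refl = actsRight-id
  ... | no i≢i   = contradiction refl i≢i

  Morᵍ-inverse : ∀ {f g} → Morᵍ i j f → IsInverse f g → Morᵍ j i g
  Morᵍ-inverse {i} {j} m inv with i ≟ j | j ≟ i
  ... | yes refl | yes refl = actsRight-inverse m inv
  ... | yes refl | no i≢i   = contradiction refl i≢i
  ... | no i≢i   | yes refl = contradiction refl i≢i
  ... | no _     | no _     = Morˢ-inverse m inv

  Morᵍ-∘ : ∀ {f g} → Morᵍ i j f → Morᵍ j k g → Morᵍ i k (g ∘ f)
  Morᵍ-∘ {i} {j} {k} mf mg with i ≟ j | j ≟ k | i ≟ k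
  ... | yes refl | yes refl | yes refl = actsRight-∘ mf mg
  ... | yes refl | yes refl | no i≢i   = contradiction refl i≢i
  ... | yes refl | no j≢j   | yes refl = contradiction refl j≢j
  ... | yes refl | no _     | no i≢k   = mf i≢k mg
  ... | no i≢j   | yes refl | yes refl = contradiction refl i≢j
  ... | no i≢j   | yes refl | no _     = actsRight⇒actsLeft mg i≢j mf
  ... | no i≢j   | no _     | yes refl = loop-actsRight i≢j mf mg
  ... | no i≢j   | no j≢k   | no i≢k   = Morˢ-∘ (≢⇒Rˢ i≢j) (≢⇒Rˢ j≢k) (≢⇒Rˢ i≢k) mf mg

  Morᵍ⇔Mor : R i j → ∀ f → Morᵍ i j f ⇔ Mor i j f
  Morᵍ⇔Mor {i} {j} r with i ≟ j
  ... | yes refl = actsRight⇔Mor r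
  ... | no _     = Morˢ⇔Mor r

  isGroupoidSpineᵍ : IsGroupoidSpine I _<_ X (λ _ _ → ⊤) Morᵍ
  isGroupoidSpineᵍ = record
    { linear       = linear
    ; X-nonempty   = X-nonempty
    ; R-nonempty   = let (i , j , _) = R-nonempty in i , j , tt
    ; <⊆R          = λ _ → tt
    ; Mor-nonempty = λ {i} {j} _ → Morᵍ-nonempty i j
    ; Mor-bij      = λ _ _ → Morᵍ-bij
    ; Mor-ext      = λ _ _ _ → Morᵍ-resp
    ; id-closed    = λ _ → Morᵍ-id
    ; inv-closed   = λ _ _ _ _ → Morᵍ-inverse
    ; comp-closed  = λ _ _ _ _ _ → Morᵍ-∘
    }

  extendsToGroupoid : ExtendsToGroupoid I _<_ X R Mor
  extendsToGroupoid = Morᵍ , (λ _ _ → Morᵍ⇔Mor) , isGroupoidSpineᵍ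

theorem7p7 : (I : Set) (_<_ : I → I → Set) (X : I → Set)
    (R : I → I → Set) (Mor : MorFamily X) →
    IsGroupoidSpine I _<_ X R Mor → IsRegular X R Mor →
    (Σ (I → I → Set) (λ S → Symmetric S × (∀ {i j} → R i j → S i j) ×
        ExtendsTo I _<_ X R Mor S))
    × (AtLeastThree I → ExtendsToGroupoid I _<_ X R Mor)
theorem7p7 I _<_ X R Mor spine regular =
  (Rˢ , Rˢ-sym , fwd , extendsToSymClosure) ,
  GroupoidExtension.extendsToGroupoid spine regular
  where open SymmetricExtension spine regular
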